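{- Let $G$ be an incidence graph and $k\ge 0$ an integer. If $\mathrm{srbd}_{\mathscr{C}_0}(G)\le k$ or $\mathrm{wrbd}_{\mathscr{C}_0}(G)\le k$, then every connected component of $G$ has diameter at most $4\cdot 2^k-4$.
   Context: CNF formulas are finite sets of clauses, each a finite set of literals $x_+$ or $x_-$ not containing both $x_+$ and $x_-$; formulas are identified with their incidence graphs (bipartite graphs on variables and clauses, with a positive edge $\{x,c\}$ if $x_+\in c$ and a negative edge if $x_-\in c$). $\mathscr{C}_0$ is the class of formulas with no clauses or only empty clauses (edgeless incidence graphs). For a variable $x$ and $\star\in\{+,-\}$, $G[x_\star]$ is the incidence graph of the formula obtained by setting $x$ to $\star$: delete all clauses containing $x_\star$ and delete the opposite literal of $x$ from the remaining clauses. For a class $\mathscr{C}$: $\mathrm{srbd}_{\mathscr{C}}(G)=0$ if $G\in\mathscr{C}$; $=1+\min_{x\in\mathrm{var}(G)}\max_{\star}\mathrm{srbd}_{\mathscr{C}}(G[x_\star])$ if $G\notin\mathscr{C}$ and $G$ is connected; otherwise the maximum of $\mathrm{srbd}_{\mathscr{C}}(H)$ over connected components $H$ of $G$. Similarly $\mathrm{wrbd}_{\mathscr{C}}(G)=0$ if $G\in\mathscr{C}$ and $G$ is satisfiable; $=\infty$ if $G\in\mathscr{C}$ and $G$ is unsatisfiable; $=1+\min_{x\in\mathrm{var}(G)}\min_{\star}\mathrm{wrbd}_{\mathscr{C}}(G[x_\star])$ if $G\notin\mathscr{C}$ and $G$ is connected; otherwise the maximum of $\mathrm{wrbd}_{\mathscr{C}}(H)$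 over connected components $H$ of $G$. -}

module Defs where

open import Data.Nat using (ℕ; zero; suc; _≤_)
open import Data.Nat as ℕ using (_⊔_)
open import Data.Bool using (Bool; true; false; _∧_; not)
open import Data.Bool.Properties using () renaming (_≟_ to _≟B_)
open import Data.Fin using (Fin; _≟_)
open import Data.Vec using (Vec; lookup)
open import Data.Maybe using (Maybe; just; nothing)
open import Data.Sum using (_⊎_; inj₁; inj₂)
open import Data.Product using (Σ; _×_; ∃; ∃-syntax)
open import Data.Empty using (⊥)
open import Data.Unit using (⊤)
open import Relation.Nullary using (¬_)
open import Relation.Nullary.Decidable using (⌊_⌋)
open import Relation.Binary.PropositionalEquality using (_≡_; _≢_)

-- A clause is a vector giving, for every variable,
-- the literal of that variable occurring in it: nothing (the variable
-- does not occur), just true (positive literal x₊) or just false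
-- (negative literal x₋).  Hence a clause never contains both x₊ and x₋.
-- The incidence graph has vertex set Fin n ⊎ Fin m, with an edge {x,c}
-- (positive / negative) iff lit F c x ≡ just true / just false.

Clause : ℕ → Set
Clause n = Vec (Maybe Bool) n

Formula : ℕ → ℕ → Set
Formula n m = Vec (Clause n) m

-- a formula is a *set* of clauses: distinct indices are distinct clauses
DistinctClauses : ∀ {n m} → Formula n m → Set
DistinctClauses {n} {m} F = (c c′ : Fin m) → lookup F c ≡ lookup F c′ → c ≡ c′

data ℕ∞ : Set where
  fin : ℕ → ℕ∞
  ∞   : ℕ∞

_≤∞_ : ℕ∞ → ℕ∞ → Set
fin a ≤∞ fin b = a ≤ b
fin a ≤∞ ∞     = ⊤
∞     ≤∞ fin b = ⊥
∞     ≤∞ ∞     = ⊤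

suc∞ : ℕ∞ → ℕ∞
suc∞ (fin a) = fin (suc a)
suc∞ ∞       = ∞

module _ {n m : ℕ} (F : Formula n m) where

  lit : Fin m → Fin n → Maybe Bool
  lit c x = lookup (lookup F c) x

  -- Every formula arising from F by partial assignments and by taking
  -- connected components is (the incidence graph induced on) a selection
  -- of variables and clauses of F.
  record Sel : Set where
    constructor sel
    field
      vs : Fin n → Bool
      cs : Fin m → Bool
  open Sel public

  full : Sel
  full = sel (λ _ → true) (λ _ → true)

  Vertex : Set
  Vertex = Fin n ⊎ Fin m

  _∈_ : Vertex → Sel → Set
  inj₁ x ∈ S = vs S x ≡ true
  inj₂ c ∈ S = cs S c ≡ true

  Adj : Sel → Vertex → Vertex → Set
  Adj S (inj₁ x) (inj₂ c) = vs S x ≡ true × cs S c ≡ true × lit c x ≢ nothing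
  Adj S (inj₂ c) (inj₁ x) = vs S x ≡ true × cs S c ≡ true × lit c x ≢ nothing
  Adj S (inj₁ _) (inj₁ _) = ⊥
  Adj S (inj₂ _) (inj₂ _) = ⊥

  data Walk (S : Sel) : Vertex → Vertex → ℕ → Set where
    here : ∀ {u} → u ∈ S → Walk S u u 0
    step : ∀ {u w v ℓ} → Adj S u w → Walk S w v ℓ → Walk S u v (suc ℓ)

  Reach : Sel → Vertex → Vertex → Set
  Reach S u v = ∃[ ℓ ] Walk S u v ℓ

  Connected : Sel → Set
  Connected S = ∀ u v → u ∈ S → v ∈ S → Reach S u v

  IsComponent : Sel → Sel → Set
  IsComponent S T =
    (∀ u → u ∈ T → u ∈ S) ×
    (∃[ u ] u ∈ T) ×
    (∀ u v → u ∈ T → v ∈ T → Reach S u v) ×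
    (∀ u v → u ∈ T → v ∈ S → Reach S u v → v ∈ T)

  InC0 : Sel → Set
  InC0 S = ∀ x c → vs S x ≡ true → cs S c ≡ true → lit c x ≡ nothing

  Satisfiable : Sel → Set
  Satisfiable S = Σ (Fin n → Bool) λ τ → (∀ c → cs S c ≡ true →
                    ∃[ x ] (vs S x ≡ true × lit c x ≡ just (τ x)))

  isLit : Maybe Bool → Bool → Bool
  isLit (just b′) b = ⌊ b′ ≟B b ⌋
  isLit nothing   b = false

  -- S[x_b]: remove x, remove the clauses containing x_b (the opposite
  -- literal disappears from the other clauses because x is removed)
  assign : Sel → Fin n → Bool → Sel
  assign S x b = sel (λ y → vs S y ∧ not ⌊ x ≟ y ⌋)
                     (λ c → cs S c ∧ not (isLit (lit c x) b))

  -- srbd_{𝒞₀}, as the graph of the function (relation "srbd(S) = d"),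
  -- by recursion on a fuel bounding the number of variables.

  mutual
    SrbdC : ℕ → Sel → ℕ → Set
    SrbdC f S d = (InC0 S × d ≡ 0) ⊎ (¬ InC0 S × SrbdStep f S d)

    SrbdStep : ℕ → Sel → ℕ → Set
    SrbdStep zero    S d = ⊥
    SrbdStep (suc f) S d =
      Σ ℕ λ d′ → d ≡ suc d′ ×
        (∃[ x ] (vs S x ≡ true × SrbdMax f S x d′)) ×
        (∀ x e → vs S x ≡ true → SrbdMax f S x e → d′ ≤ e)

    SrbdMax : ℕ → Sel → Fin n → ℕ → Set
    SrbdMax f S x e = Σ ℕ λ e₊ → Σ ℕ λ e₋ →
      Srbd f (assign S x true) e₊ × Srbd f (assign S x false) e₋ × e ≡ e₊ ⊔ e₋

    Srbd : ℕ → Sel → ℕ → Set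
    Srbd f S d =
      (InC0 S × d ≡ 0) ⊎
      (¬ InC0 S × Connected S × SrbdC f S d) ⊎
      (¬ InC0 S × ¬ Connected S ×
        (∀ T → IsComponent S T → ∃[ e ] (SrbdC f T e × e ≤ d)) ×
        (∃[ T ] (IsComponent S T × SrbdC f T d)))

  WBase : Sel → ℕ∞ → Set
  WBase S d = (Satisfiable S × d ≡ fin 0) ⊎ (¬ Satisfiable S × d ≡ ∞)

  mutual
    WrbdC : ℕ → Sel → ℕ∞ → Set
    WrbdC f S d = (InC0 S × WBase S d) ⊎ (¬ InC0 S × WrbdStep f S d)

    WrbdStep : ℕ → Sel → ℕ∞ → Set
    WrbdStep zero    S d = ⊥
    WrbdStep (suc f) S d =
      Σ ℕ∞ λ d′ → d ≡ suc∞ d′ ×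
        (∃[ x ] (vs S x ≡ true × ∃[ b ] Wrbd f (assign S x b) d′)) ×
        (∀ x b e → vs S x ≡ true → Wrbd f (assign S x b) e → d′ ≤∞ e)

    Wrbd : ℕ → Sel → ℕ∞ → Set
    Wrbd f S d =
      (InC0 S × WBase S d) ⊎
      (¬ InC0 S × Connected S × WrbdC f S d) ⊎
      (¬ InC0 S × ¬ Connected S ×
        (∀ T → IsComponent S T → ∃[ e ] (WrbdC f T e × e ≤∞ d)) ×
        (∃[ T ] (IsComponent S T × WrbdC f T d)))

  -- srbd_{𝒞₀}(G) = d  and  wrbd_{𝒞₀}(G) = d  for the formula G = F
  -- (fuel n suffices: every assignment step removes one of ≤ n variables)
  SrbdIs : ℕ → Set
  SrbdIs d = Srbd n full d

  WrbdIs : ℕ∞ → Set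
  WrbdIs d = Wrbd n full d

  ComponentDiamAtMost : ℕ → Set
  ComponentDiamAtMost D =
    ∀ u v → Reach full u v → ∃[ ℓ ] (ℓ ≤ D × Walk full u v ℓ)

-- Setting a variable x deletes only x and clauses containing x, all of them
-- at distance at most 1 from x. Hence if every component of G[x_b] has
-- diameter at most A and G is connected, each vertex of G reaches x within
-- A + 2 steps (walk inside G[x_b] to the last vertex before the walk first
-- touches the deleted part), and G has diameter at most 2(A + 2). Edgeless
-- graphs have diameter 0, so induction along the decomposition tree gives the
-- bound D(0) = 0, D(k+1) = 2(D(k) + 2), that is D(k) = 4·2^k − 4. For srbd the
-- branch x₊ suffices (the maximum bounds it); for wrbd the minimising branch
-- is finite.
module Submission where

open import Defs
open import Data.Nat using (ℕ; _≤_; _*_; _^_; _∸_)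
open import Data.Sum using (_⊎_)
open import Data.Product using (Σ; _×_)

open import Data.Nat using (zero; suc; _+_; _<_; z≤n; s≤s; _⊔_)
open import Data.Nat.Properties
  using (≤-refl; ≤-trans; ≤-reflexive; <-≤-trans; +-mono-≤; +-mono-<-≤; +-mono-≤-<;
         +-monoˡ-≤; +-comm; m≤m⊔n; m≤n+m; n≤1+n; m+n∸n≡m)
open import Data.Nat.Tactic.RingSolver using (solve-∀)
open import Data.Bool using (Bool; true; not; _∧_)
open import Data.Bool.Properties using (∧-conicalˡ; ∧-identityʳ; ∧-zeroʳ) renaming (_≟_ to _≟ᵇ_)
open import Data.Fin using (Fin) renaming (_≟_ to _≟ᶠ_)
open import Data.Fin.Properties using (any?)
open import Data.Fin.Subset using (_⊆_; ∣_∣) renaming (_∈_ to _∈ᶠ_)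
open import Data.Fin.Subset.Properties using (p⊆q⇒∣p∣≤∣q∣; p⊂q⇒∣p∣<∣q∣)
open import Data.Vec using (tabulate)
open import Data.Vec.Properties using (lookup∘tabulate; []=⇒lookup; lookup⇒[]=)
open import Data.Maybe using (Maybe; just; nothing)
open import Data.Maybe.Properties using () renaming (≡-dec to ≡-decᵐ)
open import Data.Sum using (inj₁; inj₂)
open import Data.Sum.Properties using (≡-dec)
open import Data.Product using (_,_; ∃-syntax; proj₁; proj₂)
open import Function using (_∘_; case_of_)
open import Relation.Nullary using (¬_; Dec; yes; no; does; contradiction)
open import Relation.Nullary.Decidable using (⌊_⌋; ¬?; map′; _×-dec_; _⊎-dec_; dec-true)
open import Relation.Binary.Definitions using (DecidableEquality)
open import Relation.Binary.PropositionalEquality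
  using (_≡_; _≢_; refl; sym; trans; cong; subst; module ≡-Reasoning)

diamBound : ℕ → ℕ
diamBound zero    = 0
diamBound (suc d) = (diamBound d + 2) + (diamBound d + 2)

diamBound-mono : ∀ {a b} → a ≤ b → diamBound a ≤ diamBound b
diamBound-mono {zero}                 _   = z≤n
diamBound-mono {suc a} {suc b} (s≤s a≤b) = +-mono-≤ bound≤ bound≤
  where
  bound≤ : diamBound a + 2 ≤ diamBound b + 2
  bound≤ = +-monoˡ-≤ 2 (diamBound-mono a≤b)

diamBound+4 : ∀ d → diamBound d + 4 ≡ 4 * 2 ^ d
diamBound+4 zero    = refl
diamBound+4 (suc d) = begin
  (diamBound d + 2) + (diamBound d + 2) + 4 ≡⟨ regroup (diamBound d) ⟩
  (diamBound d + 4) + (diamBound d + 4)     ≡⟨ cong (λ t → t + t) (diamBound+4 d) ⟩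
  4 * 2 ^ d + 4 * 2 ^ d                     ≡⟨ double (2 ^ d) ⟩
  4 * (2 * 2 ^ d)                           ∎
  where
  open ≡-Reasoning
  regroup : ∀ x → (x + 2) + (x + 2) + 4 ≡ (x + 4) + (x + 4)
  regroup = solve-∀
  double : ∀ y → 4 * y + 4 * y ≡ 4 * (2 * y)
  double = solve-∀

diamBound≤ : ∀ {d k} → d ≤ k → diamBound d ≤ 4 * 2 ^ k ∸ 4
diamBound≤ {d} {k} d≤k = ≤-trans (diamBound-mono d≤k) (≤-reflexive closedForm)
  where
  closedForm : diamBound k ≡ 4 * 2 ^ k ∸ 4
  closedForm = trans (sym (m+n∸n≡m (diamBound k) 4)) (cong (_∸ 4) (diamBound+4 k))

_≟ᵐ_ : DecidableEquality (Maybe Bool)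
_≟ᵐ_ = ≡-decᵐ _≟ᵇ_

does≡true⇒ : ∀ {A : Set} (a? : Dec A) → does a? ≡ true → A
does≡true⇒ (yes a) _  = a
does≡true⇒ (no _)  ()

module _ {k : ℕ} where

  ∈-tabulate⁺ : ∀ {f : Fin k → Bool} {i} → f i ≡ true → i ∈ᶠ tabulate f
  ∈-tabulate⁺ {f} {i} fi = lookup⇒[]= i _ (trans (lookup∘tabulate f i) fi)

  ∈-tabulate⁻ : ∀ {f : Fin k → Bool} {i} → i ∈ᶠ tabulate f → f i ≡ true
  ∈-tabulate⁻ {f} {i} i∈f = trans (sym (lookup∘tabulate f i)) ([]=⇒lookup i∈f)

  tabulate-⊆ : ∀ {f g : Fin k → Bool} → (∀ i → f i ≡ true → g i ≡ true) → tabulate f ⊆ tabulate g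
  tabulate-⊆ {f} {g} f⇒g {i} = ∈-tabulate⁺ {g} ∘ f⇒g i ∘ ∈-tabulate⁻ {f}

module _ {n m : ℕ} (F : Formula n m) where

  private
    V : Set
    V = Vertex F

  infix 4 _∈ˢ_ _⊆ˢ_

  _∈ˢ_ : V → Sel F → Set
  u ∈ˢ S = _∈_ F u S

  _⊆ˢ_ : Sel F → Sel F → Set
  T ⊆ˢ S = ∀ u → u ∈ˢ T → u ∈ˢ S

  Within : Sel F → ℕ → V → V → Set
  Within S j u v = ∃[ ℓ ] (ℓ ≤ j × Walk F S u v ℓ)

  DiamAtMost : Sel F → ℕ → Set
  DiamAtMost S D = ∀ u v → Reach F S u v → Within S D u v

  -- Walks

  module _ {S : Sel F} where

    Adj-∈ˡ : ∀ {u w} → Adj F S u w → u ∈ˢ S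
    Adj-∈ˡ {inj₁ _} {inj₂ _} (x∈S , _ , _) = x∈S
    Adj-∈ˡ {inj₂ _} {inj₁ _} (_ , c∈S , _) = c∈S

    Adj-∈ʳ : ∀ {u w} → Adj F S u w → w ∈ˢ S
    Adj-∈ʳ {inj₁ _} {inj₂ _} (_ , c∈S , _) = c∈S
    Adj-∈ʳ {inj₂ _} {inj₁ _} (x∈S , _ , _) = x∈S

    Adj-sym : ∀ {u w} → Adj F S u w → Adj F S w u
    Adj-sym {inj₁ _} {inj₂ _} u~w = u~w
    Adj-sym {inj₂ _} {inj₁ _} u~w = u~w

    Adj-restrict : ∀ {T u w} → u ∈ˢ T → w ∈ˢ T → Adj F S u w → Adj F T u w
    Adj-restrict {u = inj₁ _} {inj₂ _} x∈T c∈T (_ , _ , x∈c) = x∈T , c∈T , x∈c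
    Adj-restrict {u = inj₂ _} {inj₁ _} c∈T x∈T (_ , _ , x∈c) = x∈T , c∈T , x∈c

    Walk-start∈ : ∀ {u v ℓ} → Walk F S u v ℓ → u ∈ˢ S
    Walk-start∈ (here u∈S)   = u∈S
    Walk-start∈ (step u~w _) = Adj-∈ˡ u~w

    Walk-end∈ : ∀ {u v ℓ} → Walk F S u v ℓ → v ∈ˢ S
    Walk-end∈ (here v∈S) = v∈S
    Walk-end∈ (step _ W) = Walk-end∈ W

    infixr 5 _++ʷ_

    _++ʷ_ : ∀ {u w v a b} → Walk F S u w a → Walk F S w v b → Walk F S u v (a + b)
    here _     ++ʷ W′ = W′
    step u~w W ++ʷ W′ = step u~w (W ++ʷ W′)

    Walk-reverse : ∀ {u v ℓ} → Walk F S u v ℓ → Walk F S v u ℓ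
    Walk-reverse (here u∈S) = here u∈S
    Walk-reverse (step {ℓ = ℓ} u~w W) =
      subst (Walk F S _ _) (+-comm ℓ 1) (Walk-reverse W ++ʷ step (Adj-sym u~w) (here (Adj-∈ˡ u~w)))

    Within-trans : ∀ {a b u w v} → Within S a u w → Within S b w v → Within S (a + b) u v
    Within-trans (ℓ , ℓ≤a , W) (ℓ′ , ℓ′≤b , W′) = ℓ + ℓ′ , +-mono-≤ ℓ≤a ℓ′≤b , W ++ʷ W′

    Within-sym : ∀ {a u v} → Within S a u v → Within S a v u
    Within-sym (ℓ , ℓ≤a , W) = ℓ , ℓ≤a , Walk-reverse W

    Within-weaken : ∀ {a b u v} → Within S a u v → a ≤ b → Within S b u v
    Within-weaken (ℓ , ℓ≤a , W) a≤b = ℓ , ≤-trans ℓ≤a a≤b , W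

  Walk-mono : ∀ {S T u v ℓ} → T ⊆ˢ S → Walk F T u v ℓ → Walk F S u v ℓ
  Walk-mono T⊆S (here u∈T)   = here (T⊆S _ u∈T)
  Walk-mono T⊆S (step u~w W) =
    step (Adj-restrict (T⊆S _ (Adj-∈ˡ u~w)) (T⊆S _ (Adj-∈ʳ u~w)) u~w) (Walk-mono T⊆S W)

  Within-mono : ∀ {S T j u v} → T ⊆ˢ S → Within T j u v → Within S j u v
  Within-mono T⊆S (ℓ , ℓ≤j , W) = ℓ , ℓ≤j , Walk-mono T⊆S W

  DiamAtMost-mono : ∀ {S a b} → DiamAtMost S a → a ≤ b → DiamAtMost S b
  DiamAtMost-mono diam a≤b u v u⇝v = Within-weaken (diam u v u⇝v) a≤b

  InC0⇒DiamAtMost : ∀ {S D} → InC0 F S → DiamAtMost S D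
  InC0⇒DiamAtMost _ u v (_ , here u∈S) = 0 , z≤n , here u∈S
  InC0⇒DiamAtMost edgeless u v (_ , step {u = inj₁ x} {inj₂ c} (x∈S , c∈S , x∈c) _) =
    contradiction (edgeless x c x∈S c∈S) x∈c
  InC0⇒DiamAtMost edgeless u v (_ , step {u = inj₂ c} {inj₁ x} (x∈S , c∈S , x∈c) _) =
    contradiction (edgeless x c x∈S c∈S) x∈c

  -- Setting a variable

  restrict : Sel F → (Fin n → Bool) → (Fin m → Bool) → Sel F
  restrict S p q = sel (λ y → vs S y ∧ p y) (λ c → cs S c ∧ q c)

  restrict-⊆ : ∀ S p q → restrict S p q ⊆ˢ S
  restrict-⊆ S p q (inj₁ y) = ∧-conicalˡ (vs S y) (p y)
  restrict-⊆ S p q (inj₂ c) = ∧-conicalˡ (cs S c) (q c)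

  assign-⊆ : ∀ S x b → assign F S x b ⊆ˢ S
  assign-⊆ S x b = restrict-⊆ S (λ y → not ⌊ x ≟ᶠ y ⌋) (λ c → not (isLit F (lit F c x) b))

  module _ {S : Sel F} {x : Fin n} (x∈S : vs S x ≡ true) (b : Bool) where

    private
      T : Sel F
      T = assign F S x b

    ∈-assign⊎near : ∀ u → u ∈ˢ S → u ∈ˢ T ⊎ Within S 1 u (inj₁ x)
    ∈-assign⊎near (inj₁ y) y∈S with x ≟ᶠ y
    ... | yes refl = inj₂ (0 , z≤n , here x∈S)
    ... | no _     = inj₁ (trans (∧-identityʳ (vs S y)) y∈S)
    ∈-assign⊎near (inj₂ c) c∈S with lit F c x in x∈c
    ... | nothing = inj₁ (trans (∧-identityʳ (cs S c)) c∈S)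
    ... | just _  = inj₂ (1 , ≤-refl , step (x∈S , c∈S , λ x∉c → case trans (sym x∈c) x∉c of λ ()) (here x∈S))

    near⊎reach-assign : ∀ {u ℓ} → Walk F S u (inj₁ x) ℓ →
      Within S 1 u (inj₁ x) ⊎ ∃[ z ] (Reach F T u z × Within S 2 z (inj₁ x))
    near⊎reach-assign (here u∈S) = inj₁ (0 , z≤n , here u∈S)
    near⊎reach-assign (step u~w W) with ∈-assign⊎near _ (Adj-∈ˡ u~w)
    ... | inj₂ u-near = inj₁ u-near
    ... | inj₁ u∈T with near⊎reach-assign W
    ...   | inj₁ (ℓ , ℓ≤1 , W′) = inj₂ (_ , (0 , here u∈T) , suc ℓ , s≤s ℓ≤1 , step u~w W′)
    ...   | inj₂ (z , (ℓ , w⇝z) , z-near) =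
      inj₂ (z , (suc ℓ , step (Adj-restrict u∈T (Walk-start∈ w⇝z) u~w) w⇝z) , z-near)

    Within-assigned : ∀ {A u} → DiamAtMost T A → Reach F S u (inj₁ x) → Within S (A + 2) u (inj₁ x)
    Within-assigned {A} T-diam (_ , W) with near⊎reach-assign W
    ... | inj₁ u-near = Within-weaken u-near (≤-trans (n≤1+n 1) (m≤n+m 2 A))
    ... | inj₂ (z , u⇝z , z-near) = Within-trans (Within-mono (assign-⊆ S x b) (T-diam _ z u⇝z)) z-near

    DiamAtMost-assign : ∀ {A} → Connected F S → DiamAtMost T A → DiamAtMost S ((A + 2) + (A + 2))
    DiamAtMost-assign {A} S-conn T-diam u v (_ , W) =
      Within-trans (toVar u (Walk-start∈ W)) (Within-sym (toVar v (Walk-end∈ W)))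
      where
      toVar : ∀ w → w ∈ˢ S → Within S (A + 2) w (inj₁ x)
      toVar w w∈S = Within-assigned T-diam (S-conn w (inj₁ x) w∈S x∈S)

  -- Connected components

  _≟ᵛ_ : DecidableEquality V
  _≟ᵛ_ = ≡-dec _≟ᶠ_ _≟ᶠ_

  deleteVertex : Sel F → V → Sel F
  deleteVertex S u = restrict S (λ y → not ⌊ u ≟ᵛ inj₁ y ⌋) (λ c → not ⌊ u ≟ᵛ inj₂ c ⌋)

  ∈-deleteVertex : ∀ {S u} w → w ∈ˢ S → u ≢ w → w ∈ˢ deleteVertex S u
  ∈-deleteVertex {S} {u} (inj₁ y) y∈S u≢y with u ≟ᵛ inj₁ y
  ... | yes u≡y = contradiction u≡y u≢y
  ... | no _    = trans (∧-identityʳ (vs S y)) y∈S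
  ∈-deleteVertex {S} {u} (inj₂ c) c∈S u≢c with u ≟ᵛ inj₂ c
  ... | yes u≡c = contradiction u≡c u≢c
  ... | no _    = trans (∧-identityʳ (cs S c)) c∈S

  ∉-deleteVertex : ∀ {S} u → ¬ u ∈ˢ deleteVertex S u
  ∉-deleteVertex {S} (inj₁ y) y∈ with inj₁ y ≟ᵛ inj₁ y
  ... | yes _ = case trans (sym (∧-zeroʳ (vs S y))) y∈ of λ ()
  ... | no y≢y = y≢y refl
  ∉-deleteVertex {S} (inj₂ c) c∈ with inj₂ c ≟ᵛ inj₂ c
  ... | yes _ = case trans (sym (∧-zeroʳ (cs S c))) c∈ of λ ()
  ... | no c≢c = c≢c refl

  size : Sel F → ℕ
  size S = ∣ tabulate (vs S) ∣ + ∣ tabulate (cs S) ∣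

  vs-⊆ : ∀ {S T} → T ⊆ˢ S → tabulate (vs T) ⊆ tabulate (vs S)
  vs-⊆ T⊆S = tabulate-⊆ (λ y → T⊆S (inj₁ y))

  cs-⊆ : ∀ {S T} → T ⊆ˢ S → tabulate (cs T) ⊆ tabulate (cs S)
  cs-⊆ T⊆S = tabulate-⊆ (λ c → T⊆S (inj₂ c))

  ⊆ˢ⇒size< : ∀ {S T} u → T ⊆ˢ S → u ∈ˢ S → ¬ u ∈ˢ T → size T < size S
  ⊆ˢ⇒size< (inj₁ y) T⊆S y∈S y∉T =
    +-mono-<-≤ (p⊂q⇒∣p∣<∣q∣ (vs-⊆ T⊆S , y , ∈-tabulate⁺ y∈S , y∉T ∘ ∈-tabulate⁻)) (p⊆q⇒∣p∣≤∣q∣ (cs-⊆ T⊆S))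
  ⊆ˢ⇒size< (inj₂ c) T⊆S c∈S c∉T =
    +-mono-≤-< (p⊆q⇒∣p∣≤∣q∣ (vs-⊆ T⊆S)) (p⊂q⇒∣p∣<∣q∣ (cs-⊆ T⊆S , c , ∈-tabulate⁺ c∈S , c∉T ∘ ∈-tabulate⁻))

  deleteVertex-⊆ : ∀ S u → deleteVertex S u ⊆ˢ S
  deleteVertex-⊆ S u = restrict-⊆ S _ _

  avoid⊎lastVisit : ∀ {S a v ℓ} u → Walk F S a v ℓ →
    Reach F (deleteVertex S u) a v ⊎ (u ≡ v ⊎ ∃[ w ] (Adj F S u w × Reach F (deleteVertex S u) w v))
  avoid⊎lastVisit {a = a} u (here a∈S) with u ≟ᵛ a
  ... | yes u≡a = inj₂ (inj₁ u≡a)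
  ... | no u≢a  = inj₁ (0 , here (∈-deleteVertex a a∈S u≢a))
  avoid⊎lastVisit {a = a} u (step a~w W) with avoid⊎lastVisit u W
  ... | inj₂ lastVisit = inj₂ lastVisit
  ... | inj₁ (ℓ , W′) with u ≟ᵛ a
  ...   | yes refl = inj₂ (inj₂ (_ , a~w , ℓ , W′))
  ...   | no u≢a   = inj₁ (suc ℓ , step (Adj-restrict (∈-deleteVertex a (Adj-∈ˡ a~w) u≢a) (Walk-start∈ W′) a~w) W′)

  Reach⇒Within : ∀ {S s u v} → size S ≤ s → Reach F S u v → Within S s u v
  Reach⇒Within {S} {s} {u} size≤s (_ , W) with avoid⊎lastVisit u W
  ... | inj₁ (_ , W′)    = contradiction (Walk-start∈ W′) (∉-deleteVertex u)
  ... | inj₂ (inj₁ refl) = 0 , z≤n , here (Walk-start∈ W)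
  ... | inj₂ (inj₂ (w , u~w , w⇝v))
    with s | <-≤-trans (⊆ˢ⇒size< u (deleteVertex-⊆ S u) (Walk-start∈ W) (∉-deleteVertex u)) size≤s
  ...   | suc s′ | s≤s size′≤s′ =
    Within-trans (1 , ≤-refl , step u~w (here (Adj-∈ʳ u~w)))
                 (Within-mono (deleteVertex-⊆ S u) (Reach⇒Within size′≤s′ w⇝v))

  ∃ᵛ? : ∀ {P : V → Set} → (∀ w → Dec (P w)) → Dec (∃[ w ] P w)
  ∃ᵛ? P? = map′ (λ { (inj₁ (y , p)) → inj₁ y , p ; (inj₂ (c , p)) → inj₂ c , p })
                (λ { (inj₁ y , p) → inj₁ (y , p) ; (inj₂ c , p) → inj₂ (c , p) })
                (any? (P? ∘ inj₁) ⊎-dec any? (P? ∘ inj₂))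

  module _ (S : Sel F) where

    ∈ˢ? : ∀ u → Dec (u ∈ˢ S)
    ∈ˢ? (inj₁ y) = vs S y ≟ᵇ true
    ∈ˢ? (inj₂ c) = cs S c ≟ᵇ true

    Adj? : ∀ u w → Dec (Adj F S u w)
    Adj? (inj₁ x) (inj₂ c) = ∈ˢ? (inj₁ x) ×-dec ∈ˢ? (inj₂ c) ×-dec ¬? (lit F c x ≟ᵐ nothing)
    Adj? (inj₂ c) (inj₁ x) = ∈ˢ? (inj₁ x) ×-dec ∈ˢ? (inj₂ c) ×-dec ¬? (lit F c x ≟ᵐ nothing)
    Adj? (inj₁ _) (inj₁ _) = no λ ()
    Adj? (inj₂ _) (inj₂ _) = no λ ()

    Within? : ∀ j u v → Dec (Within S j u v)
    Within? zero u v = map′ stay stay⁻¹ ((u ≟ᵛ v) ×-dec ∈ˢ? u)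
      where
      stay : u ≡ v × u ∈ˢ S → Within S 0 u v
      stay (refl , u∈S) = 0 , z≤n , here u∈S
      stay⁻¹ : Within S 0 u v → u ≡ v × u ∈ˢ S
      stay⁻¹ (0 , _ , here u∈S) = refl , u∈S
    Within? (suc j) u v =
      map′ move move⁻¹ (Within? zero u v ⊎-dec ∃ᵛ? (λ w → Adj? u w ×-dec Within? j w v))
      where
      move : Within S 0 u v ⊎ ∃[ w ] (Adj F S u w × Within S j w v) → Within S (suc j) u v
      move (inj₁ stay) = Within-weaken stay z≤n
      move (inj₂ (_ , u~w , ℓ , ℓ≤j , W)) = suc ℓ , s≤s ℓ≤j , step u~w W
      move⁻¹ : Within S (suc j) u v → Within S 0 u v ⊎ ∃[ w ] (Adj F S u w × Within S j w v)
      move⁻¹ (0 , _ , here u∈S) = inj₁ (0 , z≤n , here u∈S)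
      move⁻¹ (suc ℓ , s≤s ℓ≤j , step u~w W) = inj₂ (_ , u~w , ℓ , ℓ≤j , W)

  select : ∀ {P : V → Set} → (∀ u → Dec (P u)) → Sel F
  select P? = sel (does ∘ P? ∘ inj₁) (does ∘ P? ∘ inj₂)

  ∈-select⁺ : ∀ {P : V → Set} (P? : ∀ u → Dec (P u)) {u} → P u → u ∈ˢ select P?
  ∈-select⁺ P? {inj₁ y} = dec-true (P? (inj₁ y))
  ∈-select⁺ P? {inj₂ c} = dec-true (P? (inj₂ c))

  ∈-select⁻ : ∀ {P : V → Set} (P? : ∀ u → Dec (P u)) {u} → u ∈ˢ select P? → P u
  ∈-select⁻ P? {inj₁ y} = does≡true⇒ (P? (inj₁ y))
  ∈-select⁻ P? {inj₂ c} = does≡true⇒ (P? (inj₂ c))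

  -- By Reach⇒Within, walks of length at most size S already reach the whole component.
  component : Sel F → V → Sel F
  component S u = select (Within? S (size S) u)

  component-isComponent : ∀ {S u} → u ∈ˢ S → IsComponent F S (component S u)
  component-isComponent {S} {u} u∈S = ⊆S , (u , ∈-component (0 , here u∈S)) , connected , closed
    where
    reach : ∀ {w} → w ∈ˢ component S u → Reach F S u w
    reach w∈ with ∈-select⁻ (Within? S (size S) u) w∈
    ... | ℓ , _ , W = ℓ , W
    ∈-component : ∀ {w} → Reach F S u w → w ∈ˢ component S u
    ∈-component = ∈-select⁺ (Within? S (size S) u) ∘ Reach⇒Within ≤-refl
    ⊆S : component S u ⊆ˢ S
    ⊆S w w∈ = Walk-end∈ (proj₂ (reach w∈))
    connected : ∀ a b → a ∈ˢ component S u → b ∈ˢ component S u → Reach F S a b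
    connected a b a∈ b∈ with reach a∈ | reach b∈
    ... | ℓ , W | ℓ′ , W′ = ℓ + ℓ′ , Walk-reverse W ++ʷ W′
    closed : ∀ a b → a ∈ˢ component S u → b ∈ˢ S → Reach F S a b → b ∈ˢ component S u
    closed a b a∈ _ (ℓ′ , W′) with reach a∈
    ... | ℓ , W = ∈-component (ℓ + ℓ′ , W ++ʷ W′)

  Walk-component : ∀ {S T a b ℓ} → IsComponent F S T → a ∈ˢ T → Walk F S a b ℓ → Walk F T a b ℓ
  Walk-component _ a∈T (here _) = here a∈T
  Walk-component {T = T} T-comp@(_ , _ , _ , closed) a∈T (step {w = w} a~w W) =
    step (Adj-restrict a∈T w∈T a~w) (Walk-component T-comp w∈T W)
    where
    w∈T : w ∈ˢ T
    w∈T = closed _ _ a∈T (Adj-∈ʳ a~w) (1 , step a~w (here (Adj-∈ʳ a~w)))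

  IsComponent⇒Connected : ∀ {S T} → IsComponent F S T → Connected F T
  IsComponent⇒Connected T-comp@(_ , _ , connected , _) a b a∈T b∈T with connected a b a∈T b∈T
  ... | ℓ , W = ℓ , Walk-component T-comp a∈T W

  DiamAtMost-components : ∀ {S D} → (∀ T → IsComponent F S T → DiamAtMost T D) → DiamAtMost S D
  DiamAtMost-components {S} T-diam u v (ℓ , W) =
    Within-mono (proj₁ T-comp) (T-diam T T-comp u v (ℓ , Walk-component T-comp u∈T W))
    where
    u∈S : u ∈ˢ S
    u∈S = Walk-start∈ W
    T : Sel F
    T = component S u
    T-comp : IsComponent F S T
    T-comp = component-isComponent u∈S
    u∈T : u ∈ˢ T
    u∈T = ∈-select⁺ (Within? S (size S) u) (0 , z≤n , here u∈S)

  -- Decomposition depth bounds the diameter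

  mutual
    SrbdC⇒DiamAtMost : ∀ f {S d} → SrbdC F f S d → Connected F S → DiamAtMost S (diamBound d)
    SrbdC⇒DiamAtMost f (inj₁ (edgeless , _)) _ = InC0⇒DiamAtMost edgeless
    SrbdC⇒DiamAtMost (suc f) (inj₂ (_ , _ , refl , (x , x∈S , e₊ , e₋ , srbd₊ , _ , refl) , _)) S-conn =
      DiamAtMost-assign x∈S true S-conn
        (DiamAtMost-mono (Srbd⇒DiamAtMost f srbd₊) (diamBound-mono (m≤m⊔n e₊ e₋)))

    Srbd⇒DiamAtMost : ∀ f {S d} → Srbd F f S d → DiamAtMost S (diamBound d)
    Srbd⇒DiamAtMost f (inj₁ (edgeless , _)) = InC0⇒DiamAtMost edgeless
    Srbd⇒DiamAtMost f (inj₂ (inj₁ (_ , S-conn , srbd))) = SrbdC⇒DiamAtMost f srbd S-conn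
    Srbd⇒DiamAtMost f (inj₂ (inj₂ (_ , _ , perComponent , _))) = DiamAtMost-components λ T T-comp →
      let e , srbd , e≤d = perComponent T T-comp
      in DiamAtMost-mono (SrbdC⇒DiamAtMost f srbd (IsComponent⇒Connected T-comp)) (diamBound-mono e≤d)

  mutual
    WrbdC⇒DiamAtMost : ∀ f {S d} → WrbdC F f S (fin d) → Connected F S → DiamAtMost S (diamBound d)
    WrbdC⇒DiamAtMost f (inj₁ (edgeless , _)) _ = InC0⇒DiamAtMost edgeless
    WrbdC⇒DiamAtMost (suc f) (inj₂ (_ , fin _ , refl , (x , x∈S , b , wrbd) , _)) S-conn =
      DiamAtMost-assign x∈S b S-conn (Wrbd⇒DiamAtMost f wrbd)
    WrbdC⇒DiamAtMost (suc f) (inj₂ (_ , ∞ , () , _))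

    Wrbd⇒DiamAtMost : ∀ f {S d} → Wrbd F f S (fin d) → DiamAtMost S (diamBound d)
    Wrbd⇒DiamAtMost f (inj₁ (edgeless , _)) = InC0⇒DiamAtMost edgeless
    Wrbd⇒DiamAtMost f (inj₂ (inj₁ (_ , S-conn , wrbd))) = WrbdC⇒DiamAtMost f wrbd S-conn
    Wrbd⇒DiamAtMost f {S} {d} (inj₂ (inj₂ (_ , _ , perComponent , _))) =
      DiamAtMost-components λ T T-comp → component-bound T-comp (perComponent T T-comp)
      where
      component-bound : ∀ {T} → IsComponent F S T → ∃[ e ] (WrbdC F f T e × e ≤∞ fin d) →
                        DiamAtMost T (diamBound d)
      component-bound T-comp (fin e , wrbd , e≤d) =
        DiamAtMost-mono (WrbdC⇒DiamAtMost f wrbd (IsComponent⇒Connected T-comp)) (diamBound-mono e≤d)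
      component-bound _ (∞ , _ , ())

lemma5p2 : ∀ {n m} (F : Formula n m) → DistinctClauses F → (k : ℕ) →
    ((Σ ℕ λ d → SrbdIs F d × d ≤ k) ⊎ (Σ ℕ∞ λ d → WrbdIs F d × d ≤∞ fin k)) →
    ComponentDiamAtMost F (4 * 2 ^ k ∸ 4)
lemma5p2 {n} F _ k (inj₁ (d , srbd , d≤k)) =
  DiamAtMost-mono F (Srbd⇒DiamAtMost F n srbd) (diamBound≤ d≤k)
lemma5p2 {n} F _ k (inj₂ (fin d , wrbd , d≤k)) =
  DiamAtMost-mono F (Wrbd⇒DiamAtMost F n wrbd) (diamBound≤ d≤k)
lemma5p2 F _ k (inj₂ (∞ , _ , ()))
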